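{- Let $F_1,\dots,F_n$ be pairwise edge-disjoint matchings, each of size $n$, in a graph. Let $R$ be a rainbow matching of maximum possible size $q$, with a fixed injection $\phi:R\to[n]$ satisfying $e\in F_{\phi(e)}$ for all $e\in R$, and let $J=[n]\setminus\phi(R)$. For $j\in J$, call a pair $\{e,f\}$ of distinct edges of $R$ half-$j$-wasteful if $F_j$ contains edges $g_e,g_f,g_{ef}$ such that $g_e$ intersects $e$ and no other edge of $R$, $g_f$ intersects $f$ and no other edge of $R$, and $g_{ef}$ intersects both $e$ and $f$. For $e\in R$ let $HW(e)$ be the set of $j\in J$ for which there is $f\in R$ with $\{e,f\}$ half-$j$-wasteful, and write $d(e)=|HW(e)|$. Let $D=\{e\in R: d(e)\ge 5\}$. Then there exist subsets $S(e)\subseteq R$, $e\in D$, such that: \begin{enumerate} \item $|S(e)|\ge \frac{d(e)}{2}$ for every $e\in D$; \item $d(f)\le 2$ for every $e\in D$ and every $f\in S(e)$; \item $S(e)\cap S(f)=\emptyset$ for all distinct $e,f\in D$. \end{enumerate}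
   Context: A rainbow matching is a matching $M$ together with an injection $\psi:M\to[n]$ with $x\in F_{\psi(x)}$ for every $x\in M$; "maximum possible size" is over all rainbow matchings. -}

module Defs where

open import Data.Nat using (ℕ)
open import Data.Fin using (Fin; _<_; _≟_)
open import Data.Fin.Properties using (any?; all?)
open import Data.Fin.Subset using (Subset; ∣_∣)
open import Data.Vec using (tabulate)
open import Data.Product using (Σ; ∃; _×_; _,_; proj₁; proj₂)
open import Data.Product.Properties using () 
open import Data.Sum using (_⊎_; inj₁; inj₂; [_,_]′)
open import Relation.Nullary using (¬_; Dec; does; yes; no)
open import Relation.Nullary.Decidable using (map′)
open import Data.Empty using (⊥-elim)
open import Function using (id)
open import Relation.Nullary.Decidable using (_×-dec_; _⊎-dec_; ¬?)
open import Relation.Binary.PropositionalEquality using (_≡_)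

-- An edge of a simple graph on vertex set Fin V, stored canonically as an
-- ordered pair (u , v) with u < v (so equal edges are equal pairs).
Edge : ℕ → Set
Edge V = Fin V × Fin V

WellFormed : ∀ {V} → Edge V → Set
WellFormed (u , v) = u < v

Meets : ∀ {V} → Edge V → Edge V → Set
Meets (u , v) (u' , v') = (u ≡ u' ⊎ u ≡ v') ⊎ (v ≡ u' ⊎ v ≡ v')

Meets? : ∀ {V} (e f : Edge V) → Dec (Meets e f)
Meets? (u , v) (u' , v') = ((u ≟ u') ⊎-dec (u ≟ v')) ⊎-dec ((v ≟ u') ⊎-dec (v ≟ v'))

-- A matching of size m, listed as m edges that are pairwise vertex-disjoint
-- (hence pairwise distinct, so the matching has exactly m edges).
IsMatching : ∀ {V m} → (Fin m → Edge V) → Set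
IsMatching {m = m} M =
  (∀ a → WellFormed (M a)) × (∀ (a b : Fin m) → ¬ a ≡ b → ¬ Meets (M a) (M b))

-- The family F₁,…,Fₙ: F i is a matching of size n (its edges F i 0, …, F i (n-1)).
-- x ∈ F i
_∈F_ : ∀ {V n} → Edge V → (Fin n → Fin n → Edge V) × Fin n → Set
x ∈F (F , i) = ∃ λ a → F i a ≡ x

IsFamily : ∀ {V n} → (Fin n → Fin n → Edge V) → Set
IsFamily {n = n} F =
  (∀ i → IsMatching (F i)) × (∀ (i j a b : Fin n) → ¬ i ≡ j → ¬ F i a ≡ F j b)

IsRainbow : ∀ {V n m} → (Fin n → Fin n → Edge V) → (Fin m → Edge V) → (Fin m → Fin n) → Set
IsRainbow {m = m} F M ψ =
  IsMatching M × (∀ (k l : Fin m) → ψ k ≡ ψ l → k ≡ l) × (∀ k → M k ∈F (F , ψ k))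

InJ : ∀ {n q} → (Fin q → Fin n) → Fin n → Set
InJ φ j = ∀ k → ¬ φ k ≡ j

MeetsOnly : ∀ {V q} → (Fin q → Edge V) → Edge V → Fin q → Set
MeetsOnly R g e = Meets g (R e) × (∀ k → ¬ k ≡ e → ¬ Meets g (R k))

HalfWasteful : ∀ {V n q} → (Fin n → Fin n → Edge V) → (Fin q → Edge V) →
               Fin n → Fin q → Fin q → Set
HalfWasteful F R j e f =
  ¬ e ≡ f ×
  ((∃ λ a → MeetsOnly R (F j a) e) × (∃ λ b → MeetsOnly R (F j b) f) ×
   (∃ λ c → Meets (F j c) (R e) × Meets (F j c) (R f)))

InHW : ∀ {V n q} → (Fin n → Fin n → Edge V) → (Fin q → Edge V) → (Fin q → Fin n) →
       Fin q → Fin n → Set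
InHW F R φ e j = InJ φ j × (∃ λ f → HalfWasteful F R j e f)

private
  other? : ∀ {V q} (R : Fin q → Edge V) g e → Dec (∀ k → ¬ k ≡ e → ¬ Meets g (R k))
  other? R g e = map′ (λ h k k≢e → [ (λ k≡e → ⊥-elim (k≢e k≡e)) , id ]′ (h k))
                      (λ h k → [ inj₁ , (λ k≢e → inj₂ (h k k≢e)) ]′ (dec⇒⊎ (k ≟ e)))
                      (all? λ k → (k ≟ e) ⊎-dec ¬? (Meets? g (R k)))
    where
    dec⇒⊎ : ∀ {A : Set} → Dec A → A ⊎ ¬ A
    dec⇒⊎ (yes a) = inj₁ a
    dec⇒⊎ (no ¬a) = inj₂ ¬a

  MeetsOnly? : ∀ {V q} (R : Fin q → Edge V) g e → Dec (MeetsOnly R g e)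
  MeetsOnly? R g e = Meets? g (R e) ×-dec other? R g e

InHW? : ∀ {V n q} (F : Fin n → Fin n → Edge V) (R : Fin q → Edge V) (φ : Fin q → Fin n)
        e j → Dec (InHW F R φ e j)
InHW? F R φ e j =
  all? (λ k → ¬? (φ k ≟ j)) ×-dec
  any? (λ f → ¬? (e ≟ f) ×-dec
    (any? (λ a → MeetsOnly? R (F j a) e) ×-dec any? (λ b → MeetsOnly? R (F j b) f) ×-dec
     any? (λ c → Meets? (F j c) (R e) ×-dec Meets? (F j c) (R f))))

card : ∀ {m} {P : Fin m → Set} → (∀ x → Dec (P x)) → ℕ
card P? = ∣ tabulate (λ x → does (P? x)) ∣

d : ∀ {V n q} → (Fin n → Fin n → Edge V) → (Fin q → Edge V) → (Fin q → Fin n) → Fin q → ℕ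
d F R φ e = card (InHW? F R φ e)

{-# OPTIONS --safe #-}
module Submission where

-- A colour j ∈ HW(e) provides, inside F_j, a pendant at e (meeting R only in e), a pendant at the
-- partner f and a connector between e and f.  Two pendants at e of distinct colours must meet,
-- since otherwise both could replace e and R would not be maximum; with d(e) ≥ 3 this forces all
-- pendants at e through one end p of e, so every connector leaves e at its other end.  A connector
-- is then determined by the partner f and the end of f it hits, whence d(e) ≤ 2 |S(e)| for the set
-- S(e) of partners.  The other two properties hold because each violation yields three or four
-- pairwise disjoint edges of distinct colours in J that meet only two or three edges of R, again
-- contradicting maximality; d(e) ≥ 5 leaves enough colours to pick a pendant avoiding a given vertex.

open import Defs
open import Data.Bool using (Bool; true; false)
import Data.Bool as Bool
open import Data.Bool.Properties using (¬-not)
open import Data.Empty using (⊥; ⊥-elim)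
open import Data.Fin as Fin using (Fin; zero; suc; _≟_; fromℕ; inject₁)
open import Data.Fin.Properties using (any?; all?; suc-injective; fromℕ≢inject₁; inject₁-injective)
import Data.Fin.Properties as Finₚ
open import Data.Fin.Subset using (Subset; _∈_; ∣_∣)
open import Data.Nat using (ℕ; zero; suc; _+_; _*_; _≤_; _<_; z≤n; s≤s; _≤?_)
open import Data.Nat.Properties
  using (≤-trans; ≤-reflexive; ≤-pred; +-monoˡ-≤; +-mono-≤; +-suc; +-identityʳ; ≰⇒>)
import Data.Nat.Properties as ℕₚ
open import Data.Product using (Σ; ∃; _×_; _,_; proj₁; proj₂)
open import Data.Sum using (_⊎_; inj₁; inj₂; [_,_]′)
open import Data.Unit using (⊤; tt)
open import Data.Vec using (Vec; []; _∷_; lookup; tabulate)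
open import Data.Vec.Properties using (lookup∘tabulate; []=⇒lookup)
open import Data.Vec.Relation.Unary.All using (All; []; _∷_)
open import Data.Vec.Relation.Unary.All.Properties using (lookup⁺)
open import Data.Vec.Relation.Unary.AllPairs using (AllPairs; []; _∷_)
open import Data.Vec.Relation.Unary.Any using (Any; here; there)
import Data.Vec.Relation.Unary.Any as Any
open import Data.Vec.Relation.Unary.Any.Properties using (lookup-index)
open import Function using (_∘_)
open import Level using (0ℓ)
open import Relation.Binary.Core using (Rel)
open import Relation.Binary.Definitions using (Symmetric)
open import Relation.Binary.PropositionalEquality
  using (_≡_; refl; sym; trans; cong; cong₂; subst; subst₂)
open import Relation.Nullary using (¬_; Dec; yes; no; does; contradiction)
open import Relation.Nullary.Decidable using (_×-dec_; _⊎-dec_; _→-dec_; ¬?)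

P⇒0<card : ∀ {m} {P : Fin m → Set} (P? : ∀ x → Dec (P x)) x → P x → 0 < card P?
P⇒0<card P? zero p with P? zero
... | yes _ = s≤s z≤n
... | no ¬p = contradiction p ¬p
P⇒0<card P? (suc x) p with P? zero
... | yes _ = s≤s z≤n
... | no _ = P⇒0<card (λ y → P? (suc y)) x p

0<card⇒∃ : ∀ {m} {P : Fin m → Set} (P? : ∀ x → Dec (P x)) → 0 < card P? → ∃ P
0<card⇒∃ {suc m} P? pos with P? zero
... | yes p = zero , p
... | no _ = let (x , px) = 0<card⇒∃ (λ y → P? (suc y)) pos in suc x , px

card-split : ∀ {m} {P Q : Fin m → Set} (P? : ∀ x → Dec (P x)) (Q? : ∀ x → Dec (Q x)) →
             card P? ≡ card (λ x → P? x ×-dec Q? x) + card (λ x → P? x ×-dec ¬? (Q? x))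
card-split {zero} P? Q? = refl
card-split {suc m} P? Q? with P? zero | Q? zero
... | yes _ | yes _ = cong suc (card-split (λ x → P? (suc x)) (λ x → Q? (suc x)))
... | yes _ | no _ = trans (cong suc (card-split (λ x → P? (suc x)) (λ x → Q? (suc x)))) (sym (+-suc _ _))
... | no _ | _ = card-split (λ x → P? (suc x)) (λ x → Q? (suc x))

card-injection-≤ : ∀ {m k} {P : Fin m → Set} {Q : Fin k → Set}
                   (P? : ∀ x → Dec (P x)) (Q? : ∀ y → Dec (Q y)) (h : ∀ x → P x → Fin k) →
                   (∀ x px → Q (h x px)) → (∀ x y px py → h x px ≡ h y py → x ≡ y) →
                   card P? ≤ card Q?
card-injection-≤ {zero} P? Q? h h∈Q h-inj = z≤n
card-injection-≤ {suc m} P? Q? h h∈Q h-inj with P? zero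
... | no _ = card-injection-≤ (λ x → P? (suc x)) Q? (λ x → h (suc x)) (λ x → h∈Q (suc x))
               (λ x y px py eq → suc-injective (h-inj _ _ px py eq))
... | yes p₀ = begin
    suc (card (λ x → P? (suc x))) ≤⟨ s≤s rest≤ ⟩
    suc (card Q∖y₀?)              ≤⟨ +-monoˡ-≤ _ (P⇒0<card Q∩y₀? y₀ (h∈Q zero p₀ , refl)) ⟩
    card Q∩y₀? + card Q∖y₀?       ≡⟨ sym (card-split Q? (_≟ y₀)) ⟩
    card Q?                       ∎
  where
  open ℕₚ.≤-Reasoning
  y₀ = h zero p₀
  Q∩y₀? = λ y → Q? y ×-dec (y ≟ y₀)
  Q∖y₀? = λ y → Q? y ×-dec ¬? (y ≟ y₀)
  rest≤ : card (λ x → P? (suc x)) ≤ card Q∖y₀?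
  rest≤ = card-injection-≤ (λ x → P? (suc x)) Q∖y₀? (λ x → h (suc x))
            (λ x px → h∈Q (suc x) px , λ eq → Finₚ.0≢1+n (sym (h-inj _ _ px p₀ eq)))
            (λ x y px py eq → suc-injective (h-inj _ _ px py eq))

card-without-unique : ∀ {m k} {P B : Fin m → Set} (P? : ∀ x → Dec (P x)) (B? : ∀ x → Dec (B x)) →
                      (∀ x y → P x → B x → P y → B y → x ≡ y) →
                      suc k ≤ card P? → k ≤ card (λ x → P? x ×-dec ¬? (B? x))
card-without-unique P? B? unique k<P =
  ≤-pred (≤-trans k<P (≤-trans (≤-reflexive (card-split P? B?)) (+-monoˡ-≤ _ P∩B≤1)))
  where
  P∩B≤1 : card (λ x → P? x ×-dec B? x) ≤ 1
  P∩B≤1 = card-injection-≤ {Q = λ (_ : Fin 1) → ⊤} (λ x → P? x ×-dec B? x) (λ _ → yes tt)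
            (λ _ _ → zero) (λ _ _ → tt)
            (λ x y (px , bx) (py , by) _ → unique x y px bx py by)

card-without-point : ∀ {m k} {P : Fin m → Set} (P? : ∀ x → Dec (P x)) (j : Fin m) →
                     suc k ≤ card P? → k ≤ card (λ x → P? x ×-dec ¬? (x ≟ j))
card-without-point P? j = card-without-unique P? (_≟ j) (λ x y _ x≡j _ y≡j → trans x≡j (sym y≡j))

allPairs-lookup : ∀ {a ℓ} {A : Set a} {_~_ : Rel A ℓ} → Symmetric _~_ →
                  ∀ {m} {xs : Vec A m} → AllPairs _~_ xs →
                  ∀ {i j} → ¬ i ≡ j → lookup xs i ~ lookup xs j
allPairs-lookup ~-sym (_ ∷ _) {zero} {zero} i≢j = contradiction refl i≢j
allPairs-lookup ~-sym (x~ ∷ _) {zero} {suc j} _ = lookup⁺ x~ j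
allPairs-lookup ~-sym (x~ ∷ _) {suc i} {zero} _ = ~-sym (lookup⁺ x~ i)
allPairs-lookup ~-sym (_ ∷ rest) {suc i} {suc j} i≢j = allPairs-lookup ~-sym rest (i≢j ∘ cong suc)

module _ {V : ℕ} where

  infix 4 _∈ᵉ_ _∈ᵉ?_

  _∈ᵉ_ : Fin V → Edge V → Set
  v ∈ᵉ g = v ≡ proj₁ g ⊎ v ≡ proj₂ g

  _∈ᵉ?_ : ∀ v g → Dec (v ∈ᵉ g)
  v ∈ᵉ? g = (v ≟ proj₁ g) ⊎-dec (v ≟ proj₂ g)

  meets⇒common : ∀ g h → Meets g h → ∃ λ v → v ∈ᵉ g × v ∈ᵉ h
  meets⇒common g h (inj₁ u∈h) = proj₁ g , inj₁ refl , u∈h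
  meets⇒common g h (inj₂ w∈h) = proj₂ g , inj₂ refl , w∈h

  common⇒meets : ∀ {v} g h → v ∈ᵉ g → v ∈ᵉ h → Meets g h
  common⇒meets g h (inj₁ refl) v∈h = inj₁ v∈h
  common⇒meets g h (inj₂ refl) v∈h = inj₂ v∈h

  meets-sym : ∀ g h → Meets g h → Meets h g
  meets-sym g h m = let (v , v∈g , v∈h) = meets⇒common g h m in common⇒meets h g v∈h v∈g

  disjoint-sym : ∀ {g h} → ¬ Meets g h → ¬ Meets h g
  disjoint-sym {g} {h} g#h = g#h ∘ meets-sym h g

  wellFormed⇒ends≢ : (g : Edge V) → WellFormed g → ¬ proj₁ g ≡ proj₂ g
  wellFormed⇒ends≢ g wf eq = Finₚ.<-irrefl eq wf

  record Endpoints (g : Edge V) (u w : Fin V) : Set where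
    constructor endpoints
    field
      left∈  : u ∈ᵉ g
      right∈ : w ∈ᵉ g
      left≢right : ¬ u ≡ w

  open Endpoints public

  endpoints-cover : ∀ {g u w v} → Endpoints g u w → v ∈ᵉ g → v ≡ u ⊎ v ≡ w
  endpoints-cover (endpoints (inj₁ refl) (inj₁ refl) u≢w) _ = contradiction refl u≢w
  endpoints-cover (endpoints (inj₁ refl) (inj₂ refl) _) v∈g = v∈g
  endpoints-cover (endpoints (inj₂ refl) (inj₁ refl) _) (inj₁ v≡w) = inj₂ v≡w
  endpoints-cover (endpoints (inj₂ refl) (inj₁ refl) _) (inj₂ v≡u) = inj₁ v≡u
  endpoints-cover (endpoints (inj₂ refl) (inj₂ refl) u≢w) _ = contradiction refl u≢w

  other-endpoint : ∀ {g u} → WellFormed g → u ∈ᵉ g → ∃ (Endpoints g u)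
  other-endpoint {g} wf (inj₁ refl) = proj₂ g , endpoints (inj₁ refl) (inj₂ refl) (wellFormed⇒ends≢ g wf)
  other-endpoint {g} wf (inj₂ refl) = proj₁ g , endpoints (inj₂ refl) (inj₁ refl) (wellFormed⇒ends≢ g wf ∘ sym)

  other-endpoint-unique : ∀ {g u w w'} → Endpoints g u w → Endpoints g u w' → w ≡ w'
  other-endpoint-unique uw uw' with endpoints-cover uw (right∈ uw')
  ... | inj₁ w'≡u = contradiction (sym w'≡u) (left≢right uw')
  ... | inj₂ w'≡w = sym w'≡w

  endpoints-⊆ : ∀ {g h u w v} → Endpoints g u w → u ∈ᵉ h → w ∈ᵉ h → v ∈ᵉ g → v ∈ᵉ h
  endpoints-⊆ uw u∈h w∈h v∈g with endpoints-cover uw v∈g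
  ... | inj₁ refl = u∈h
  ... | inj₂ refl = w∈h

  edge-≡ : ∀ {g h u w} → WellFormed g → WellFormed h → Endpoints g u w → u ∈ᵉ h → w ∈ᵉ h → g ≡ h
  edge-≡ {g} wf-g wf-h uw u∈h w∈h
    with endpoints-⊆ uw u∈h w∈h (inj₁ refl) | endpoints-⊆ uw u∈h w∈h (inj₂ refl)
  ... | inj₁ g₁≡h₁ | inj₁ g₂≡h₁ = contradiction (trans g₁≡h₁ (sym g₂≡h₁)) (wellFormed⇒ends≢ g wf-g)
  ... | inj₁ g₁≡h₁ | inj₂ g₂≡h₂ = cong₂ _,_ g₁≡h₁ g₂≡h₂
  ... | inj₂ g₁≡h₂ | inj₁ g₂≡h₁ = ⊥-elim (Finₚ.<-asym wf-h (subst₂ Fin._<_ g₁≡h₂ g₂≡h₁ wf-g))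
  ... | inj₂ g₁≡h₂ | inj₂ g₂≡h₂ = contradiction (trans g₁≡h₂ (sym g₂≡h₂)) (wellFormed⇒ends≢ g wf-g)

  disjoint-by-endpoints : ∀ {g h u₁ u₂ w₁ w₂} → Endpoints g u₁ u₂ → Endpoints h w₁ w₂ →
                          ¬ u₁ ≡ w₁ → ¬ u₁ ≡ w₂ → ¬ u₂ ≡ w₁ → ¬ u₂ ≡ w₂ → ¬ Meets g h
  disjoint-by-endpoints {g} {h} gu hw u₁≢w₁ u₁≢w₂ u₂≢w₁ u₂≢w₂ m
    with meets⇒common g h m
  ... | v , v∈g , v∈h with endpoints-cover gu v∈g | endpoints-cover hw v∈h
  ... | inj₁ refl | inj₁ refl = u₁≢w₁ refl
  ... | inj₁ refl | inj₂ refl = u₁≢w₂ refl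
  ... | inj₂ refl | inj₁ refl = u₂≢w₁ refl
  ... | inj₂ refl | inj₂ refl = u₂≢w₂ refl

  same-side : ∀ {g u w} → u ∈ᵉ g → w ∈ᵉ g → does (u ≟ proj₁ g) ≡ does (w ≟ proj₁ g) → u ≡ w
  same-side {g} {u} {w} u∈g w∈g eq with u ≟ proj₁ g | w ≟ proj₁ g
  ... | yes u≡ | yes w≡ = trans u≡ (sym w≡)
  ... | no u≢ | no w≢ = trans (second u∈g u≢) (sym (second w∈g w≢))
    where
    second : ∀ {v} → v ∈ᵉ g → ¬ v ≡ proj₁ g → v ≡ proj₂ g
    second (inj₁ v≡) v≢ = contradiction v≡ v≢
    second (inj₂ v≡) _ = v≡
  same-side u∈g w∈g () | yes _ | no _
  same-side u∈g w∈g () | no _ | yes _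

module MaximumRainbow {V n : ℕ} (F : Fin n → Fin n → Edge V) (family : IsFamily F)
  {q : ℕ} (R : Fin q → Edge V) (φ : Fin q → Fin n) (rainbow : IsRainbow F R φ)
  (maximum : (m : ℕ) (M : Fin m → Edge V) (ψ : Fin m → Fin n) → IsRainbow F M ψ → m ≤ q) where

  F-wellFormed : ∀ j a → WellFormed (F j a)
  F-wellFormed j = proj₁ (proj₁ family j)

  F-meet⇒≡ : ∀ {j a b} → Meets (F j a) (F j b) → a ≡ b
  F-meet⇒≡ {j} {a} {b} m with a ≟ b
  ... | yes a≡b = a≡b
  ... | no a≢b = contradiction m (proj₂ (proj₁ family j) a b a≢b)

  F-colour-unique : ∀ {j k a b} → F j a ≡ F k b → j ≡ k
  F-colour-unique {j} {k} {a} {b} eq with j ≟ k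
  ... | yes j≡k = j≡k
  ... | no j≢k = contradiction eq (proj₂ family j k a b j≢k)

  R-wellFormed : ∀ k → WellFormed (R k)
  R-wellFormed = proj₁ (proj₁ rainbow)

  R-disjoint : ∀ k l → ¬ k ≡ l → ¬ Meets (R k) (R l)
  R-disjoint = proj₂ (proj₁ rainbow)

  φ-injective : ∀ {k l} → φ k ≡ φ l → k ≡ l
  φ-injective = proj₁ (proj₂ rainbow) _ _

  R-coloured : ∀ k → R k ∈F (F , φ k)
  R-coloured = proj₂ (proj₂ rainbow)

  R-vertex-unique : ∀ {v k l} → v ∈ᵉ R k → v ∈ᵉ R l → k ≡ l
  R-vertex-unique {v} {k} {l} v∈k v∈l with k ≟ l
  ... | yes k≡l = k≡l
  ... | no k≢l = contradiction (common⇒meets (R k) (R l) v∈k v∈l) (R-disjoint k l k≢l)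

  Uncovered : Fin V → Set
  Uncovered v = ∀ k → ¬ v ∈ᵉ R k

  ≢-across : ∀ {u w k l} → u ∈ᵉ R k → w ∈ᵉ R l → ¬ k ≡ l → ¬ u ≡ w
  ≢-across u∈k w∈l k≢l refl = k≢l (R-vertex-unique u∈k w∈l)

  covered≢uncovered : ∀ {u w k} → u ∈ᵉ R k → Uncovered w → ¬ u ≡ w
  covered≢uncovered {k = k} u∈k w-free refl = w-free k u∈k

  uncovered≢covered : ∀ {u w k} → Uncovered u → w ∈ᵉ R k → ¬ u ≡ w
  uncovered≢covered u-free w∈k = covered≢uncovered w∈k u-free ∘ sym

  meetsOnly⇒≡ : ∀ {g e k} → MeetsOnly R g e → Meets g (R k) → k ≡ e
  meetsOnly⇒≡ {e = e} {k} (_ , others) m with k ≟ e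
  ... | yes k≡e = k≡e
  ... | no k≢e = contradiction m (others k k≢e)

  edge : Fin n × Fin n → Edge V
  edge (c , a) = F c a

  Independent : Rel (Fin n × Fin n) 0ℓ
  Independent x y = ¬ proj₁ x ≡ proj₁ y × ¬ Meets (edge x) (edge y)

  independent-sym : Symmetric Independent
  independent-sym {x} {y} (c≢ , ¬m) = c≢ ∘ sym , ¬m ∘ meets-sym (edge y) (edge x)

  -- Every slot k is refilled by the new edge at the position of k in slots and the last new edge is
  -- added, giving a rainbow matching with q + 1 edges.
  augment : ∀ {t} (new : Vec (Fin n × Fin n) (suc t)) (slots : Vec (Fin q) t) →
            All (InJ φ ∘ proj₁) new → AllPairs Independent new →
            All (λ x → ∀ k → Meets (edge x) (R k) → Any (k ≡_) slots) new → ⊥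
  augment {t} new slots new-in-J new-independent new-covered =
    ℕₚ.<-irrefl refl (maximum (suc q) (edge ∘ entry) (proj₁ ∘ entry)
      ( (entry-wellFormed , λ a b a≢b → proj₂ (entry-independent a≢b))
      , entry-colour-injective , λ a → proj₂ (entry a) , refl))
    where
    old : Fin q → Fin n × Fin n
    old k = φ k , proj₁ (R-coloured k)

    edge-old : ∀ k → edge (old k) ≡ R k
    edge-old k = proj₂ (R-coloured k)

    pick : ∀ k → Dec (Any (k ≡_) slots) → Fin n × Fin n
    pick k (yes k∈) = lookup new (inject₁ (Any.index k∈))
    pick k (no _) = old k

    slot? : ∀ k → Dec (Any (k ≡_) slots)
    slot? k = Any.any? (k ≟_) slots

    entry : Fin (suc q) → Fin n × Fin n
    entry zero = lookup new (fromℕ t)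
    entry (suc k) = pick k (slot? k)

    new-new : ∀ {s s'} → ¬ s ≡ s' → Independent (lookup new s) (lookup new s')
    new-new = allPairs-lookup independent-sym new-independent

    new-old : ∀ s l → ¬ Any (l ≡_) slots → Independent (lookup new s) (old l)
    new-old s l l∉ = (λ eq → lookup⁺ new-in-J s l (sym eq))
                   , λ m → l∉ (lookup⁺ new-covered s l (subst (Meets _) (edge-old l) m))

    old-old : ∀ {k l} → ¬ k ≡ l → Independent (old k) (old l)
    old-old {k} {l} k≢l = k≢l ∘ φ-injective
                        , λ m → R-disjoint k l k≢l (subst₂ Meets (edge-old k) (edge-old l) m)

    pick-independent : ∀ {k l} → ¬ k ≡ l → ∀ dk dl → Independent (pick k dk) (pick l dl)
    pick-independent k≢l (yes k∈) (yes l∈) =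
      new-new λ eq → k≢l (trans (lookup-index k∈)
                           (trans (cong (lookup slots) (inject₁-injective eq)) (sym (lookup-index l∈))))
    pick-independent k≢l (yes _) (no l∉) = new-old _ _ l∉
    pick-independent k≢l (no k∉) (yes _) = independent-sym (new-old _ _ k∉)
    pick-independent k≢l (no _) (no _) = old-old k≢l

    last-independent : ∀ l dl → Independent (lookup new (fromℕ t)) (pick l dl)
    last-independent l (yes _) = new-new fromℕ≢inject₁
    last-independent l (no l∉) = new-old _ l l∉

    entry-wellFormed : ∀ a → WellFormed (edge (entry a))
    entry-wellFormed a = F-wellFormed (proj₁ (entry a)) (proj₂ (entry a))

    entry-independent : ∀ {a b} → ¬ a ≡ b → Independent (entry a) (entry b)
    entry-independent {zero} {zero} a≢b = contradiction refl a≢b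
    entry-independent {zero} {suc l} _ = last-independent l (slot? l)
    entry-independent {suc k} {zero} _ = independent-sym (last-independent k (slot? k))
    entry-independent {suc k} {suc l} a≢b = pick-independent (a≢b ∘ cong suc) (slot? k) (slot? l)

    entry-colour-injective : ∀ a b → proj₁ (entry a) ≡ proj₁ (entry b) → a ≡ b
    entry-colour-injective a b eq with a ≟ b
    ... | yes a≡b = a≡b
    ... | no a≢b = contradiction eq (proj₁ (entry-independent a≢b))

  record Pendant (e : Fin q) (j : Fin n) : Set where
    field
      colour∈J : InJ φ j
      index : Fin n
      only : MeetsOnly R (F j index) e
      base outer : Fin V
      ends : Endpoints (F j index) base outer
      base∈e : base ∈ᵉ R e
      outer-free : Uncovered outer

    coloured : Fin n × Fin n
    coloured = j , index

    covers : ∀ {k} → Meets (F j index) (R k) → k ≡ e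
    covers = meetsOnly⇒≡ only

    isolated : ∀ {c k} → Meets (F j c) (R k) → ¬ k ≡ e → ¬ Meets (F j index) (F j c)
    isolated c-k k≢e m = k≢e (covers (subst (λ a → Meets (F j a) _) (sym (F-meet⇒≡ m)) c-k))

  open Pendant

  -- The outer end is uncovered: otherwise the pendant would be R e, whose colour is not in J.
  pendant : ∀ {e j a} → InJ φ j → MeetsOnly R (F j a) e → Pendant e j
  pendant {e} {j} {a} j∈J only =
    let (p , p∈g , p∈e) = meets⇒common (F j a) (R e) (proj₁ only)
        (w , p-w) = other-endpoint (F-wellFormed j a) p∈g
        (i , F≡R) = R-coloured e
        w-free : Uncovered w
        w-free k w∈k =
          let w∈e = subst (λ l → w ∈ᵉ R l) (meetsOnly⇒≡ only (common⇒meets (F j a) (R k) (right∈ p-w) w∈k)) w∈k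
              Fja≡Re = edge-≡ (F-wellFormed j a) (R-wellFormed e) p-w p∈e w∈e
          in j∈J e (sym (F-colour-unique (trans Fja≡Re (sym F≡R))))
    in record { colour∈J = j∈J ; index = a ; only = only ; base = p ; outer = w ; ends = p-w
              ; base∈e = p∈e ; outer-free = w-free }

  pendants-meet : ∀ {e j k} → ¬ j ≡ k → (P : Pendant e j) (P' : Pendant e k) →
                  Meets (F j (index P)) (F k (index P'))
  pendants-meet {e} {j} {k} j≢k P P' with Meets? (F j (index P)) (F k (index P'))
  ... | yes m = m
  ... | no ¬m = ⊥-elim (augment (coloured P ∷ coloured P' ∷ []) (e ∷ [])
                          (colour∈J P ∷ colour∈J P' ∷ []) (((j≢k , ¬m) ∷ []) ∷ [] ∷ [])
                          ((λ _ → here ∘ covers P) ∷ (λ _ → here ∘ covers P') ∷ []))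

  pendants-share-vertex : ∀ {e j k} → ¬ j ≡ k → (P : Pendant e j) (P' : Pendant e k) →
                          base P ≡ base P' ⊎ outer P ≡ outer P'
  pendants-share-vertex j≢k P P' with meets⇒common _ _ (pendants-meet j≢k P P')
  ... | v , v∈P , v∈P' with endpoints-cover (ends P) v∈P | endpoints-cover (ends P') v∈P'
  ... | inj₁ v≡p | inj₁ v≡p' = inj₁ (trans (sym v≡p) v≡p')
  ... | inj₁ v≡p | inj₂ v≡w' =
    contradiction (trans (sym v≡p) v≡w') (covered≢uncovered (base∈e P) (outer-free P'))
  ... | inj₂ v≡w | inj₁ v≡p' =
    contradiction (trans (sym v≡w) v≡p') (uncovered≢covered (outer-free P) (base∈e P'))
  ... | inj₂ v≡w | inj₂ v≡w' = inj₂ (trans (sym v≡w) v≡w')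

  pendants-differ : ∀ {e j k} → ¬ j ≡ k → (P : Pendant e j) (P' : Pendant e k) →
                    base P ≡ base P' → outer P ≡ outer P' → ⊥
  pendants-differ {j = j} {k} j≢k P P' p≡p' w≡w' =
    j≢k (F-colour-unique (edge-≡ (F-wellFormed j (index P)) (F-wellFormed k (index P')) (ends P)
      (subst (_∈ᵉ F k (index P')) (sym p≡p') (left∈ (ends P')))
      (subst (_∈ᵉ F k (index P')) (sym w≡w') (right∈ (ends P')))))

  pendants-share-base₃ : ∀ {e j k l} (P : Pendant e j) (P' : Pendant e k) (P'' : Pendant e l) →
                         ¬ j ≡ k → ¬ j ≡ l → ¬ k ≡ l → base P ≡ base P'
  pendants-share-base₃ P P' P'' j≢k j≢l k≢l with base P ≟ base P'
  ... | yes p≡p' = p≡p'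
  ... | no p≢p' with pendants-share-vertex j≢k P P'
  ...   | inj₁ p≡p' = contradiction p≡p' p≢p'
  ...   | inj₂ w≡w' with pendants-share-vertex j≢l P P''
  ...     | inj₁ p≡p'' with pendants-share-vertex k≢l P' P''
  ...       | inj₁ p'≡p'' = contradiction (trans p≡p'' (sym p'≡p'')) p≢p'
  ...       | inj₂ w'≡w'' = ⊥-elim (pendants-differ j≢l P P'' p≡p'' (trans w≡w' w'≡w''))
  pendants-share-base₃ P P' P'' j≢k j≢l k≢l | no p≢p' | inj₂ w≡w' | inj₂ w≡w''
    with endpoints-cover (endpoints (base∈e P) (base∈e P') p≢p') (base∈e P'')
  ... | inj₁ p''≡p = ⊥-elim (pendants-differ j≢l P P'' (sym p''≡p) w≡w'')
  ... | inj₂ p''≡p' = ⊥-elim (pendants-differ k≢l P' P'' (sym p''≡p') (trans (sym w≡w') w≡w''))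

  -- With R e = {p, o} and R f = {y, y'}, F j contains the pendants {p, a} at e and {y', b} at f
  -- and the connector {o, y}.
  record Config (e f : Fin q) (j : Fin n) : Set where
    field
      e≢f : ¬ e ≡ f
      P : Pendant e j
      Q : Pendant f j
      connector : Fin n
      o y : Fin V
      connector-ends : Endpoints (F j connector) o y
      o∈e : o ∈ᵉ R e
      y∈f : y ∈ᵉ R f
      e-ends : Endpoints (R e) (base P) o
      f-ends : Endpoints (R f) y (base Q)

    coloured-connector : Fin n × Fin n
    coloured-connector = j , connector

    connector-meets-e : Meets (F j connector) (R e)
    connector-meets-e = common⇒meets _ _ (left∈ connector-ends) o∈e

    connector-covers : ∀ {k} → Meets (F j connector) (R k) → k ≡ e ⊎ k ≡ f
    connector-covers {k} m with meets⇒common _ (R k) m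
    ... | v , v∈c , v∈k with endpoints-cover connector-ends v∈c
    ...   | inj₁ refl = inj₁ (R-vertex-unique v∈k o∈e)
    ...   | inj₂ refl = inj₂ (R-vertex-unique v∈k y∈f)

  open Config

  config : ∀ {e f j} → InJ φ j → HalfWasteful F R j e f → Config e f j
  config {e} {f} {j} j∈J (e≢f , (a , P-only) , (b , Q-only) , (c , c-e , c-f)) =
    let P = pendant j∈J P-only
        Q = pendant j∈J Q-only
        (o , o∈c , o∈e) = meets⇒common (F j c) (R e) c-e
        (y , y∈c , y∈f) = meets⇒common (F j c) (R f) c-f
    in record
      { e≢f = e≢f ; P = P ; Q = Q ; connector = c ; o = o ; y = y
      ; connector-ends = endpoints o∈c y∈c (≢-across o∈e y∈f e≢f)
      ; o∈e = o∈e ; y∈f = y∈f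
      ; e-ends = endpoints (base∈e P) o∈e λ p≡o →
          isolated P c-f (e≢f ∘ sym)
            (common⇒meets (F j a) (F j c) (left∈ (ends P)) (subst (_∈ᵉ F j c) (sym p≡o) o∈c))
      ; f-ends = endpoints y∈f (base∈e Q) λ y≡y' →
          isolated Q c-e e≢f
            (common⇒meets (F j b) (F j c) (left∈ (ends Q)) (subst (_∈ᵉ F j c) y≡y' y∈c))
      }

  HW-pendant : ∀ {e j} → InHW F R φ e j → Pendant e j
  HW-pendant (j∈J , _ , _ , (_ , only) , _) = pendant j∈J only

  another-colour : ∀ {e} → 3 ≤ d F R φ e → ∀ j k → ∃ λ l → InHW F R φ e l × ¬ l ≡ j × ¬ l ≡ k
  another-colour {e} 3≤d j k =
    let (l , (l∈HW , l≢j) , l≢k) =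
          0<card⇒∃ (λ x → (InHW? F R φ e x ×-dec ¬? (x ≟ j)) ×-dec ¬? (x ≟ k))
            (card-without-point (λ x → InHW? F R φ e x ×-dec ¬? (x ≟ j)) k
              (card-without-point (InHW? F R φ e) j 3≤d))
    in l , l∈HW , l≢j , l≢k

  pendants-share-base : ∀ {e j k} → 3 ≤ d F R φ e → (P : Pendant e j) (P' : Pendant e k) → ¬ j ≡ k →
                        base P ≡ base P'
  pendants-share-base 3≤d P P' j≢k =
    let (l , l∈HW , l≢j , l≢k) = another-colour 3≤d _ _
    in pendants-share-base₃ P P' (HW-pendant l∈HW) j≢k (l≢j ∘ sym) (l≢k ∘ sym)

  MeetsOnly? : ∀ g e → Dec (MeetsOnly R g e)
  MeetsOnly? g e = Meets? g (R e) ×-dec all? (λ k → ¬? (k ≟ e) →-dec ¬? (Meets? g (R k)))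

  5≤⇒3≤ : ∀ {x} → 5 ≤ x → 3 ≤ x
  5≤⇒3≤ = ≤-trans (s≤s (s≤s (s≤s z≤n)))

  uncovered-on-one-pendant : ∀ {e w j k} → 3 ≤ d F R φ e → Uncovered w →
                             (P : Pendant e j) (P' : Pendant e k) →
                             w ∈ᵉ F j (index P) → w ∈ᵉ F k (index P') → j ≡ k
  uncovered-on-one-pendant {w = w} {j} {k} 3≤d w-free P P' w∈P w∈P' with j ≟ k
  ... | yes j≡k = j≡k
  ... | no j≢k = ⊥-elim (pendants-differ j≢k P P' (pendants-share-base 3≤d P P' j≢k)
                           (trans (sym (w≡outer P w∈P)) (w≡outer P' w∈P')))
    where
    w≡outer : ∀ {e c} (P : Pendant e c) → w ∈ᵉ F c (index P) → w ≡ outer P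
    w≡outer P w∈P with endpoints-cover (ends P) w∈P
    ... | inj₁ w≡p = contradiction w≡p (uncovered≢covered w-free (base∈e P))
    ... | inj₂ w≡o = w≡o

  fresh-colour : ∀ {e w} → 5 ≤ d F R φ e → (j k l : Fin n) → Uncovered w →
                 ∃ λ β → Σ (Pendant e β) λ P → ¬ β ≡ j × ¬ β ≡ k × ¬ β ≡ l × ¬ w ∈ᵉ F β (index P)
  fresh-colour {e} {w} 5≤d j k l w-free =
    let (β , ((((β∈HW , β≢j) , β≢k) , β≢l) , w∉β)) =
          0<card⇒∃ (λ x → avoiding? x ×-dec ¬? (at-w? x))
            (card-without-unique avoiding? at-w? unique
              (card-without-point (λ x → (InHW? F R φ e x ×-dec ¬? (x ≟ j)) ×-dec ¬? (x ≟ k)) l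
                (card-without-point (λ x → InHW? F R φ e x ×-dec ¬? (x ≟ j)) k
                  (card-without-point (InHW? F R φ e) j 5≤d))))
        P = HW-pendant β∈HW
    in β , P , β≢j , β≢k , β≢l , λ w∈ → w∉β (index P , only P , w∈)
    where
    Avoiding : Fin n → Set
    Avoiding x = ((InHW F R φ e x × ¬ x ≡ j) × ¬ x ≡ k) × ¬ x ≡ l
    PendantThrough : Fin n → Set
    PendantThrough x = ∃ λ a → MeetsOnly R (F x a) e × w ∈ᵉ F x a
    avoiding? : ∀ x → Dec (Avoiding x)
    avoiding? x = ((InHW? F R φ e x ×-dec ¬? (x ≟ j)) ×-dec ¬? (x ≟ k)) ×-dec ¬? (x ≟ l)
    at-w? : ∀ x → Dec (PendantThrough x)
    at-w? x = any? λ a → MeetsOnly? (F x a) e ×-dec (w ∈ᵉ? F x a)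
    unique : ∀ x y → Avoiding x → PendantThrough x → Avoiding y → PendantThrough y → x ≡ y
    unique x y (((x∈HW , _) , _) , _) (a , a-only , w∈a) (((y∈HW , _) , _) , _) (b , b-only , w∈b) =
      uncovered-on-one-pendant (5≤⇒3≤ 5≤d) w-free
        (pendant (proj₁ x∈HW) a-only) (pendant (proj₁ y∈HW) b-only) w∈a w∈b

  pendant#connector : ∀ {e f j α} (g : Config e f j) (P' : Pendant e α) → base P' ≡ base (P g) →
                      ¬ Meets (F α (index P')) (F j (connector g))
  pendant#connector g P' p'≡p =
    disjoint-by-endpoints (ends P') (connector-ends g)
      (λ p'≡o → left≢right (e-ends g) (trans (sym p'≡p) p'≡o))
      (≢-across (base∈e P') (y∈f g) (e≢f g))
      (uncovered≢covered (outer-free P') (o∈e g))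
      (uncovered≢covered (outer-free P') (y∈f g))

  connector#pendant : ∀ {e f j α} (g : Config e f j) (P' : Pendant f α) → base P' ≡ base (Q g) →
                      ¬ Meets (F j (connector g)) (F α (index P'))
  connector#pendant g P' p'≡y' =
    disjoint-by-endpoints (connector-ends g) (ends P')
      (≢-across (o∈e g) (base∈e P') (e≢f g))
      (covered≢uncovered (o∈e g) (outer-free P'))
      (λ y≡p' → left≢right (f-ends g) (trans y≡p' p'≡y'))
      (covered≢uncovered (y∈f g) (outer-free P'))

  pendant#far-connector : ∀ {e e' f j α} (P' : Pendant e α) (g : Config e' f j) → ¬ e ≡ e' → ¬ e ≡ f →
                          ¬ Meets (F α (index P')) (F j (connector g))
  pendant#far-connector P' g e≢e' e≢f =
    disjoint-by-endpoints (ends P') (connector-ends g)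
      (≢-across (base∈e P') (o∈e g) e≢e')
      (≢-across (base∈e P') (y∈f g) e≢f)
      (uncovered≢covered (outer-free P') (o∈e g))
      (uncovered≢covered (outer-free P') (y∈f g))

  pendants#far : ∀ {e f j k} → ¬ e ≡ f → (P : Pendant e j) (P' : Pendant f k) → ¬ outer P ≡ outer P' →
                 ¬ Meets (F j (index P)) (F k (index P'))
  pendants#far e≢f P P' w≢w' =
    disjoint-by-endpoints (ends P) (ends P')
      (≢-across (base∈e P) (base∈e P') e≢f)
      (covered≢uncovered (base∈e P) (outer-free P'))
      (uncovered≢covered (outer-free P) (base∈e P'))
      w≢w'

  avoids⇒outer≢ : ∀ {e f j k} (P : Pendant e j) (P' : Pendant f k) → ¬ outer P' ∈ᵉ F j (index P) →
                  ¬ outer P ≡ outer P'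
  avoids⇒outer≢ P P' w'∉P w≡w' = w'∉P (subst (_∈ᵉ _) w≡w' (right∈ (ends P)))

  Partner : Fin q → Fin q → Set
  Partner e f = ∃ λ j → InJ φ j × HalfWasteful F R j e f

  Partner? : ∀ e f → Dec (Partner e f)
  Partner? e f = any? λ j → all? (λ k → ¬? (φ k ≟ j)) ×-dec halfWasteful? j
    where
    halfWasteful? : ∀ j → Dec (HalfWasteful F R j e f)
    halfWasteful? j = ¬? (e ≟ f) ×-dec
      (any? (λ a → MeetsOnly? (F j a) e) ×-dec any? (λ b → MeetsOnly? (F j b) f) ×-dec
       any? (λ c → Meets? (F j c) (R e) ×-dec Meets? (F j c) (R f)))

  S : Fin q → Subset q
  S e = tabulate λ f → does (Partner? e f)

  ∈S⇒Partner : ∀ {e f} → f ∈ S e → Partner e f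
  ∈S⇒Partner {e} {f} f∈Se
    with Partner? e f | trans (sym (lookup∘tabulate (λ f → does (Partner? e f)) f)) ([]=⇒lookup f∈Se)
  ... | yes e-f | _ = e-f
  ... | no _ | ()

  connector-determines-colour : ∀ {e f j k} → 3 ≤ d F R φ e → (g : Config e f j) (g' : Config e f k) →
                                does (y g ≟ proj₁ (R f)) ≡ does (y g' ≟ proj₁ (R f)) → j ≡ k
  connector-determines-colour {e} {f} {j} {k} 3≤d g g' same-end with j ≟ k
  ... | yes j≡k = j≡k
  ... | no j≢k = F-colour-unique (edge-≡ (F-wellFormed j (connector g)) (F-wellFormed k (connector g'))
                   (connector-ends g)
                   (subst (_∈ᵉ F k (connector g')) (sym o≡o') (left∈ (connector-ends g')))
                   (subst (_∈ᵉ F k (connector g')) (sym y≡y') (right∈ (connector-ends g'))))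
    where
    p≡p' : base (P g) ≡ base (P g')
    p≡p' = pendants-share-base 3≤d (P g) (P g') j≢k
    o≡o' : o g ≡ o g'
    o≡o' = other-endpoint-unique (e-ends g) (subst (λ v → Endpoints (R e) v (o g')) (sym p≡p') (e-ends g'))
    y≡y' : y g ≡ y g'
    y≡y' = same-side (y∈f g) (y∈f g') same-end

  module _ (e : Fin q) where

    canonical : ∀ x → InHW F R φ e x → InHW F R φ e x
    canonical x hx with InHW? F R φ e x
    ... | yes hx' = hx'
    ... | no ¬hx = contradiction hx ¬hx

    hits-first-end : Fin n → Bool
    hits-first-end x with InHW? F R φ e x
    ... | yes (x∈J , f , hw) = does (y (config x∈J hw) ≟ proj₁ (R f))
    ... | no _ = false

    canonical-partner : ∀ x → InHW F R φ e x → Fin q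
    canonical-partner x hx = proj₁ (proj₂ (canonical x hx))

    canonical-partner-injective : 3 ≤ d F R φ e → ∀ x x' hx hx' → hits-first-end x ≡ hits-first-end x' →
                                  canonical-partner x hx ≡ canonical-partner x' hx' → x ≡ x'
    canonical-partner-injective 3≤d x x' hx hx' with InHW? F R φ e x | InHW? F R φ e x'
    ... | no ¬hx | _ = contradiction hx ¬hx
    ... | yes _ | no ¬hx' = contradiction hx' ¬hx'
    ... | yes (x∈J , f , hw) | yes (x'∈J , f' , hw') = λ { same-end refl →
          connector-determines-colour 3≤d (config x∈J hw) (config x'∈J hw') same-end }

    S-large : 5 ≤ d F R φ e → d F R φ e ≤ 2 * ∣ S e ∣
    S-large 5≤d = begin
      d F R φ e
        ≡⟨ card-split (InHW? F R φ e) first? ⟩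
      card (λ x → InHW? F R φ e x ×-dec first? x) + card (λ x → InHW? F R φ e x ×-dec ¬? (first? x))
        ≤⟨ +-mono-≤ (into-S first? (λ b b' → trans b (sym b')))
                    (into-S (¬? ∘ first?) (λ b b' → trans (¬-not b) (sym (¬-not b')))) ⟩
      ∣ S e ∣ + ∣ S e ∣
        ≡⟨ cong (∣ S e ∣ +_) (sym (+-identityʳ _)) ⟩
      2 * ∣ S e ∣ ∎
      where
      open ℕₚ.≤-Reasoning
      first? : ∀ x → Dec (hits-first-end x ≡ true)
      first? x = hits-first-end x Bool.≟ true
      into-S : {B : Fin n → Set} (B? : ∀ x → Dec (B x)) →
               (∀ {x x'} → B x → B x' → hits-first-end x ≡ hits-first-end x') →
               card (λ x → InHW? F R φ e x ×-dec B? x) ≤ ∣ S e ∣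
      into-S B? same-end =
        card-injection-≤ (λ x → InHW? F R φ e x ×-dec B? x) (Partner? e)
          (λ x (hx , _) → canonical-partner x hx)
          (λ x (hx , _) → let (x∈J , _ , hw) = canonical x hx in x , x∈J , hw)
          (λ x x' (hx , bx) (hx' , bx') → canonical-partner-injective (5≤⇒3≤ 5≤d) x x' hx hx' (same-end bx bx'))

  partner-of-heavy-is-light : ∀ {e x} → 5 ≤ d F R φ e → Partner e x → ¬ 3 ≤ d F R φ x
  partner-of-heavy-is-light {e} {x} 5≤d (j , j∈J , hw) 3≤dx =
    let g = config j∈J hw
        (γ , γ∈HW , γ≢j , _) = another-colour 3≤dx j j
        Pγ = HW-pendant γ∈HW
        (α , Pα , α≢j , α≢γ , _ , outer-γ∉Pα) = fresh-colour 5≤d j γ γ (outer-free Pγ)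
    in augment (coloured Pα ∷ coloured-connector g ∷ coloured Pγ ∷ []) (e ∷ x ∷ [])
         (colour∈J Pα ∷ j∈J ∷ colour∈J Pγ ∷ [])
         ( ( (α≢j , pendant#connector g Pα (pendants-share-base (5≤⇒3≤ 5≤d) Pα (P g) α≢j))
           ∷ (α≢γ , pendants#far (e≢f g) Pα Pγ (avoids⇒outer≢ Pα Pγ outer-γ∉Pα)) ∷ [])
         ∷ ((γ≢j ∘ sym , connector#pendant g Pγ (pendants-share-base 3≤dx Pγ (Q g) γ≢j)) ∷ [])
         ∷ [] ∷ [])
         ( (λ _ → here ∘ covers Pα)
         ∷ (λ _ → [ here , there ∘ here ]′ ∘ connector-covers g)
         ∷ (λ _ → there ∘ here ∘ covers Pγ) ∷ [])

  partners-disjoint-same-colour : ∀ {e e' x j} → ¬ e ≡ e' → Config e x j → Config e' x j → ⊥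
  partners-disjoint-same-colour {e' = e'} {j = j} e≢e' g g' with endpoints-cover (f-ends g) (y∈f g')
  ... | inj₁ y'≡y =
    [ e≢e' ∘ sym , e≢f g' ]′
      (connector-covers g (subst (λ c → Meets (F j c) (R e')) (sym C≡C') (connector-meets-e g')))
    where
    C≡C' : connector g ≡ connector g'
    C≡C' = F-meet⇒≡ (common⇒meets _ _ (right∈ (connector-ends g))
             (subst (_∈ᵉ F j (connector g')) y'≡y (right∈ (connector-ends g'))))
  ... | inj₂ y'≡base =
    e≢f g' (covers (Q g) (subst (λ c → Meets (F j c) (R e')) (sym Q≡C') (connector-meets-e g')))
    where
    Q≡C' : index (Q g) ≡ connector g'
    Q≡C' = F-meet⇒≡ (common⇒meets _ _ (left∈ (ends (Q g)))
             (subst (_∈ᵉ F j (connector g')) y'≡base (right∈ (connector-ends g'))))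

  -- If both connectors reach the same end of x, a fresh pendant at e, the connector of g and the
  -- pendant of g' at x replace e and x; otherwise a pendant at e, both connectors and a fresh
  -- pendant at e' replace e, x and e'.
  partners-disjoint-distinct-colours : ∀ {e e' x j k} → 5 ≤ d F R φ e → 5 ≤ d F R φ e' →
                                       ¬ e ≡ e' → ¬ j ≡ k → Config e x j → Config e' x k → ⊥
  partners-disjoint-distinct-colours {e} {e'} {x} {j} {k} 5≤d 5≤d' e≢e' j≢k g g'
    with endpoints-cover (f-ends g) (y∈f g')
  ... | inj₁ y'≡y =
    let (α , Pα , α≢j , α≢k , _ , b'∉Pα) = fresh-colour 5≤d j k k (outer-free (Q g'))
    in augment (coloured Pα ∷ coloured-connector g ∷ coloured (Q g') ∷ []) (e ∷ x ∷ [])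
         (colour∈J Pα ∷ colour∈J (P g) ∷ colour∈J (Q g') ∷ [])
         ( ( (α≢j , pendant#connector g Pα (pendants-share-base (5≤⇒3≤ 5≤d) Pα (P g) α≢j))
           ∷ (α≢k , pendants#far (e≢f g) Pα (Q g') (avoids⇒outer≢ Pα (Q g') b'∉Pα)) ∷ [])
         ∷ ((j≢k , connector#pendant g (Q g') y''≡y') ∷ [])
         ∷ [] ∷ [])
         ( (λ _ → here ∘ covers Pα)
         ∷ (λ _ → [ here , there ∘ here ]′ ∘ connector-covers g)
         ∷ (λ _ → there ∘ here ∘ covers (Q g')) ∷ [])
    where
    y''≡y' : base (Q g') ≡ base (Q g)
    y''≡y' = other-endpoint-unique (f-ends g') (subst (λ v → Endpoints (R x) v (base (Q g))) (sym y'≡y) (f-ends g))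
  ... | inj₂ y'≡base =
    let (α , α∈HW , α≢j , α≢k) = another-colour (5≤⇒3≤ 5≤d) j k
        Pα = HW-pendant α∈HW
        (β , Pβ , β≢j , β≢k , β≢α , outer-α∉Pβ) = fresh-colour 5≤d' j k α (outer-free Pα)
    in augment (coloured Pα ∷ coloured-connector g ∷ coloured-connector g' ∷ coloured Pβ ∷ [])
         (e ∷ x ∷ e' ∷ [])
         (colour∈J Pα ∷ colour∈J (P g) ∷ colour∈J (P g') ∷ colour∈J Pβ ∷ [])
         ( ( (α≢j , pendant#connector g Pα (pendants-share-base (5≤⇒3≤ 5≤d) Pα (P g) α≢j))
           ∷ (α≢k , pendant#far-connector Pα g' e≢e' (e≢f g))
           ∷ (β≢α ∘ sym , pendants#far e≢e' Pα Pβ (avoids⇒outer≢ Pβ Pα outer-α∉Pβ ∘ sym)) ∷ [])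
         ∷ ( (j≢k , connectors#)
           ∷ (β≢j ∘ sym , disjoint-sym (pendant#far-connector Pβ g (e≢e' ∘ sym) (e≢f g'))) ∷ [])
         ∷ ( (β≢k ∘ sym
             , disjoint-sym (pendant#connector g' Pβ (pendants-share-base (5≤⇒3≤ 5≤d') Pβ (P g') β≢k)))
           ∷ [])
         ∷ [] ∷ [])
         ( (λ _ → here ∘ covers Pα)
         ∷ (λ _ → [ here , there ∘ here ]′ ∘ connector-covers g)
         ∷ (λ _ → [ there ∘ there ∘ here , there ∘ here ]′ ∘ connector-covers g')
         ∷ (λ _ → there ∘ there ∘ here ∘ covers Pβ) ∷ [])
    where
    connectors# : ¬ Meets (F j (connector g)) (F k (connector g'))
    connectors# = disjoint-by-endpoints (connector-ends g) (connector-ends g')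
      (≢-across (o∈e g) (o∈e g') e≢e')
      (≢-across (o∈e g) (y∈f g') (e≢f g))
      (≢-across (y∈f g) (o∈e g') (e≢f g' ∘ sym))
      (λ y≡y' → left≢right (f-ends g) (trans y≡y' y'≡base))

  partners-disjoint : ∀ {e e' x} → 5 ≤ d F R φ e → 5 ≤ d F R φ e' → ¬ e ≡ e' →
                      Partner e x → Partner e' x → ⊥
  partners-disjoint 5≤d 5≤d' e≢e' (j , j∈J , hw) (k , k∈J , hw') with j ≟ k
  ... | yes refl = partners-disjoint-same-colour e≢e' (config j∈J hw) (config k∈J hw')
  ... | no j≢k = partners-disjoint-distinct-colours 5≤d 5≤d' e≢e' j≢k (config j∈J hw) (config k∈J hw')

  S-light : ∀ e f → 5 ≤ d F R φ e → f ∈ S e → d F R φ f ≤ 2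
  S-light e f 5≤d f∈Se with 3 ≤? d F R φ f
  ... | yes 3≤df = contradiction 3≤df (partner-of-heavy-is-light 5≤d (∈S⇒Partner f∈Se))
  ... | no 3≰df = ≤-pred (≰⇒> 3≰df)

  S-disjoint : ∀ e e' x → 5 ≤ d F R φ e → 5 ≤ d F R φ e' → ¬ e ≡ e' → x ∈ S e → x ∈ S e' → ⊥
  S-disjoint e e' x 5≤d 5≤d' e≢e' x∈Se x∈Se' =
    partners-disjoint 5≤d 5≤d' e≢e' (∈S⇒Partner x∈Se) (∈S⇒Partner x∈Se')

lemma2p8 : (V n : ℕ) (F : Fin n → Fin n → Edge V) → IsFamily F →
    (q : ℕ) (R : Fin q → Edge V) (φ : Fin q → Fin n) → IsRainbow F R φ →
    ((m : ℕ) (M : Fin m → Edge V) (ψ : Fin m → Fin n) → IsRainbow F M ψ → m ≤ q) →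
    Σ (Fin q → Subset q) (λ S →
      (∀ e → 5 ≤ d F R φ e → d F R φ e ≤ 2 * ∣ S e ∣) ×
      (∀ e f → 5 ≤ d F R φ e → f ∈ S e → d F R φ f ≤ 2) ×
      (∀ e f (x : Fin q) → 5 ≤ d F R φ e → 5 ≤ d F R φ f → ¬ e ≡ f →
         x ∈ S e → x ∈ S f → ⊥))
lemma2p8 V n F family q R φ rainbow maximum = S , S-large , S-light , S-disjoint
  where open MaximumRainbow F family R φ rainbow maximum
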